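{- Let $A\in\mathbb{C}$ with $A(A^2+4)\ne0$. For any positive even integer $n$, $$A^2\det[x\delta_{jk}-u_{j+k}(A,-1)]_{1\le j,k\le n}=A^2x^n-A\,u_n(A,-1)v_{n+1}(A,-1)\,x^{n-1}-u_n(A,-1)^2x^{n-2},$$ where $\delta_{jk}$ is $1$ if $j=k$ and $0$ otherwise.
   Context: For $a,b\in\mathbb{C}$, the Lucas sequences are defined by $u_0(a,b)=0$, $u_1(a,b)=1$, $v_0(a,b)=2$, $v_1(a,b)=a$, and $u_{m+1}(a,b)=au_m(a,b)-bu_{m-1}(a,b)$, $v_{m+1}(a,b)=av_m(a,b)-bv_{m-1}(a,b)$ for $m\ge1$. The convention $0^0=1$ is used. -}

module Defs where

open import Level using (Level)
open import Algebra.Bundles using (CommutativeRing)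
open import Data.Nat using (ℕ; zero; suc)
open import Data.Fin using (Fin; zero; suc; punchIn)

-- All definitions are over an arbitrary commutative ring R
-- (the paper works in ℂ).

module _ {c ℓ : Level} (R : CommutativeRing c ℓ) where
  open CommutativeRing R hiding (zero)

  pow : Carrier → ℕ → Carrier
  pow x zero    = 1#
  pow x (suc m) = x * pow x m

  lucasU : Carrier → Carrier → ℕ → Carrier
  lucasU a b zero          = 0#
  lucasU a b (suc zero)    = 1#
  lucasU a b (suc (suc m)) = a * lucasU a b (suc m) - b * lucasU a b m

  lucasV : Carrier → Carrier → ℕ → Carrier
  lucasV a b zero          = 1# + 1#
  lucasV a b (suc zero)    = a
  lucasV a b (suc (suc m)) = a * lucasV a b (suc m) - b * lucasV a b m

  sumFin : {n : ℕ} → (Fin n → Carrier) → Carrier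
  sumFin {zero}  f = 0#
  sumFin {suc n} f = f zero + sumFin (λ i → f (suc i))

  signFin : {n : ℕ} → Fin n → Carrier
  signFin zero    = 1#
  signFin (suc j) = - signFin j

  det : {n : ℕ} → (Fin n → Fin n → Carrier) → Carrier
  det {zero}  M = 1#
  det {suc n} M =
    sumFin (λ j → signFin j * (M zero j * det (λ r k → M (suc r) (punchIn j k))))

  δ : {n : ℕ} → Fin n → Fin n → Carrier
  δ zero    zero    = 1#
  δ zero    (suc k) = 0#
  δ (suc j) zero    = 0#
  δ (suc j) (suc k) = δ j k

{-# OPTIONS --safe #-}

-- By the addition formula u (m + n + 1) = u (m + 1) u (n + 1) + u m u n, row 2 + r of the
-- Hankel matrix H = (u (j + k + 2)) is u (r + 1) times row 0 plus u (r + 2) times row 1, so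
-- x I − H is a rank-two perturbation of x I.  Row operations reduce det (x I − H) to x^(n−2)
-- times a 2 × 2 determinant whose entries are sums of products u (r + i + 4) u (r + j + 1).
-- Multiplied by A these sums telescope, for n even, to u n · u (n + i + j); Cassini's identity
-- u n · u (n + 2) − u (n + 1)² = −1 (n even) and v (n + 1) = u (n + 2) + u n then give the formula.

module Submission where

open import Defs
open import Level using (Level)
open import Algebra.Bundles using (CommutativeRing)
open import Data.Nat using (ℕ; zero; suc; _<_; _∸_) renaming (_+_ to _+ℕ_)
open import Data.Nat.Divisibility using (_∣_)
open import Data.Fin using (Fin; toℕ)
open import Relation.Nullary using (¬_)

open import Data.Nat.Divisibility using (divides)
import Data.Nat as ℕ
import Data.Nat.Properties as ℕₚ
open import Data.Nat.Tactic.RingSolver using (solve-∀)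
open import Relation.Binary.PropositionalEquality as ≡ using (_≡_)

-- The ring solver for R with integer coefficients, read along the canonical map ℤ → R.
-- Coefficients are compared in ℤ, so that cancellations such as x - x = 0 are recognised.
module IntegerCoefficients {c ℓ : Level} (R : CommutativeRing c ℓ) where

  import Algebra.Properties.Ring as RingProperties
  import Algebra.Properties.CommutativeSemigroup as CommutativeSemigroupProperties
  import Algebra.Properties.Semiring.Mult.TCOptimised as Mult
  import Algebra.Solver.Ring
  open import Algebra.Solver.Ring.AlmostCommutativeRing
    using (fromCommutativeRing; _-Raw-AlmostCommutative⟶_)
  open import Data.Nat using (zero; suc)
  open import Data.Integer using (ℤ; +_; -[1+_]; _⊖_; +-*-rawRing)
    renaming (_+_ to _+ℤ_; _*_ to _*ℤ_; -_ to -ℤ_; _≟_ to _≟ℤ_)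
  import Data.Integer.Properties as ℤ
  open import Data.Maybe using (Maybe; just; nothing)
  open import Relation.Nullary using (yes; no)

  open CommutativeRing R
  open RingProperties ring using (-0#≈0#; -‿involutive; -‿distribˡ-*; -‿distribʳ-*; -‿+-comm)
  open Mult semiring using (_×_; 1+×; ×-homo-+; ×1-homo-*)
  open import Relation.Binary.Reasoning.Setoid setoid

  ⟦_⟧ℤ : ℤ → Carrier
  ⟦ + n ⟧ℤ      = n × 1#
  ⟦ -[1+ n ] ⟧ℤ = - (suc n × 1#)

  ⟦-⟧ℤ : ∀ i → ⟦ -ℤ i ⟧ℤ ≈ - ⟦ i ⟧ℤ
  ⟦-⟧ℤ (+ zero)  = sym -0#≈0#
  ⟦-⟧ℤ (+ suc n) = refl
  ⟦-⟧ℤ -[1+ n ]  = sym (-‿involutive _)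

  private
    cancel-1+ : ∀ a b → (1# + a) - (1# + b) ≈ a - b
    cancel-1+ a b = begin
      (1# + a) + - (1# + b)    ≈⟨ +-congˡ (-‿+-comm 1# b) ⟨
      (1# + a) + (- 1# + - b)  ≈⟨ interchange 1# a (- 1#) (- b) ⟩
      (1# + - 1#) + (a + - b)  ≈⟨ +-congʳ (-‿inverseʳ 1#) ⟩
      0# + (a - b)             ≈⟨ +-identityˡ _ ⟩
      a - b                    ∎
      where open CommutativeSemigroupProperties +-commutativeSemigroup using (interchange)

  ⟦⊖⟧ℤ : ∀ m n → ⟦ m ⊖ n ⟧ℤ ≈ m × 1# - n × 1#
  ⟦⊖⟧ℤ zero    zero    = sym (-‿inverseʳ 0#)
  ⟦⊖⟧ℤ zero    (suc n) = sym (+-identityˡ _)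
  ⟦⊖⟧ℤ (suc m) zero    = trans (sym (+-identityʳ _)) (+-congˡ (sym -0#≈0#))
  ⟦⊖⟧ℤ (suc m) (suc n) = begin
    ⟦ suc m ⊖ suc n ⟧ℤ                   ≡⟨ ≡.cong ⟦_⟧ℤ (ℤ.[1+m]⊖[1+n]≡m⊖n m n) ⟩
    ⟦ m ⊖ n ⟧ℤ                           ≈⟨ ⟦⊖⟧ℤ m n ⟩
    m × 1# - n × 1#                      ≈⟨ cancel-1+ _ _ ⟨
    (1# + m × 1#) - (1# + n × 1#)        ≈⟨ +-cong (1+× m 1#) (-‿cong (1+× n 1#)) ⟨
    suc m × 1# - suc n × 1#              ∎

  ⟦+⟧ℤ : ∀ i j → ⟦ i +ℤ j ⟧ℤ ≈ ⟦ i ⟧ℤ + ⟦ j ⟧ℤ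
  ⟦+⟧ℤ (+ m)    (+ n)    = trans (reflexive (≡.cong ⟦_⟧ℤ (≡.sym (ℤ.pos-+ m n)))) (×-homo-+ 1# m n)
  ⟦+⟧ℤ (+ m)    -[1+ n ] = ⟦⊖⟧ℤ m (suc n)
  ⟦+⟧ℤ -[1+ m ] (+ n)    = trans (⟦⊖⟧ℤ n (suc m)) (+-comm _ _)
  ⟦+⟧ℤ -[1+ m ] -[1+ n ] = begin
    ⟦ -[1+ m ] +ℤ -[1+ n ] ⟧ℤ              ≡⟨ ≡.cong ⟦_⟧ℤ (ℤ.neg-distrib-+ (+ suc m) (+ suc n)) ⟨
    ⟦ -ℤ (+ suc m +ℤ + suc n) ⟧ℤ           ≈⟨ ⟦-⟧ℤ (+ suc m +ℤ + suc n) ⟩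
    - ⟦ + suc m +ℤ + suc n ⟧ℤ              ≈⟨ -‿cong (⟦+⟧ℤ (+ suc m) (+ suc n)) ⟩
    - (suc m × 1# + suc n × 1#)            ≈⟨ -‿+-comm _ _ ⟨
    ⟦ -[1+ m ] ⟧ℤ + ⟦ -[1+ n ] ⟧ℤ          ∎

  private
    ⟦*⟧ℤ-pos : ∀ m j → ⟦ + m *ℤ j ⟧ℤ ≈ m × 1# * ⟦ j ⟧ℤ
    ⟦*⟧ℤ-pos m (+ n)    = trans (reflexive (≡.cong ⟦_⟧ℤ (≡.sym (ℤ.pos-* m n)))) (×1-homo-* m n)
    ⟦*⟧ℤ-pos m -[1+ n ] = begin
      ⟦ + m *ℤ -[1+ n ] ⟧ℤ        ≡⟨ ≡.cong ⟦_⟧ℤ (ℤ.neg-distribʳ-* (+ m) (+ suc n)) ⟨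
      ⟦ -ℤ (+ m *ℤ + suc n) ⟧ℤ    ≈⟨ ⟦-⟧ℤ (+ m *ℤ + suc n) ⟩
      - ⟦ + m *ℤ + suc n ⟧ℤ       ≈⟨ -‿cong (⟦*⟧ℤ-pos m (+ suc n)) ⟩
      - (m × 1# * suc n × 1#)     ≈⟨ -‿distribʳ-* _ _ ⟩
      m × 1# * ⟦ -[1+ n ] ⟧ℤ      ∎

  ⟦*⟧ℤ : ∀ i j → ⟦ i *ℤ j ⟧ℤ ≈ ⟦ i ⟧ℤ * ⟦ j ⟧ℤ
  ⟦*⟧ℤ (+ m)    j = ⟦*⟧ℤ-pos m j
  ⟦*⟧ℤ -[1+ m ] j = begin
    ⟦ -[1+ m ] *ℤ j ⟧ℤ          ≡⟨ ≡.cong ⟦_⟧ℤ (ℤ.neg-distribˡ-* (+ suc m) j) ⟨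
    ⟦ -ℤ (+ suc m *ℤ j) ⟧ℤ      ≈⟨ ⟦-⟧ℤ (+ suc m *ℤ j) ⟩
    - ⟦ + suc m *ℤ j ⟧ℤ         ≈⟨ -‿cong (⟦*⟧ℤ-pos (suc m) j) ⟩
    - (suc m × 1# * ⟦ j ⟧ℤ)     ≈⟨ -‿distribˡ-* _ _ ⟩
    ⟦ -[1+ m ] ⟧ℤ * ⟦ j ⟧ℤ      ∎

  ℤ⟶R : +-*-rawRing -Raw-AlmostCommutative⟶ fromCommutativeRing R
  ℤ⟶R = record
    { ⟦_⟧ = ⟦_⟧ℤ ; +-homo = ⟦+⟧ℤ ; *-homo = ⟦*⟧ℤ ; -‿homo = ⟦-⟧ℤ
    ; 0-homo = refl ; 1-homo = refl }

  _≟⟦⟧_ : ∀ i j → Maybe (⟦ i ⟧ℤ ≈ ⟦ j ⟧ℤ)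
  i ≟⟦⟧ j with i ≟ℤ j
  ... | yes ≡.refl = just refl
  ... | no _       = nothing

  open Algebra.Solver.Ring +-*-rawRing (fromCommutativeRing R) ℤ⟶R _≟⟦⟧_ public

module Summation {c ℓ : Level} (R : CommutativeRing c ℓ) where

  open import Data.Nat using (ℕ; zero; suc)
  open import Data.Fin using (Fin; zero; suc; toℕ; inject₁; fromℕ)
  open import Data.Fin.Properties using (toℕ-inject₁; toℕ-fromℕ)
  open import Function using (_∘_)

  open CommutativeRing R hiding (zero)
  open import Algebra.Properties.Ring ring using (-0#≈0#; -‿+-comm)
  open import Algebra.Properties.Semiring.Sum semiring
    using (sum; sum-cong-≋; ∑-distrib-+; *-distribˡ-sum; sum-init-last)
  open import Relation.Binary.Reasoning.Setoid setoid

  private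
    variable
      n : ℕ

  sumFin≡sum : (f : Fin n → Carrier) → sumFin R f ≡ sum f
  sumFin≡sum {zero}  f = ≡.refl
  sumFin≡sum {suc n} f = ≡.cong (f zero +_) (sumFin≡sum (f ∘ suc))

  sumFin-cong : {f g : Fin n → Carrier} → (∀ i → f i ≈ g i) → sumFin R f ≈ sumFin R g
  sumFin-cong {f = f} {g} p rewrite sumFin≡sum f | sumFin≡sum g = sum-cong-≋ p

  sumFin-+ : (f g : Fin n → Carrier) → sumFin R (λ i → f i + g i) ≈ sumFin R f + sumFin R g
  sumFin-+ f g rewrite sumFin≡sum (λ i → f i + g i) | sumFin≡sum f | sumFin≡sum g =
    ∑-distrib-+ f g

  *-distribˡ-sumFin : ∀ a (f : Fin n → Carrier) → a * sumFin R f ≈ sumFin R (λ i → a * f i)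
  *-distribˡ-sumFin a f rewrite sumFin≡sum f | sumFin≡sum (λ i → a * f i) = *-distribˡ-sum a f

  sumFin-zero : (f : Fin n → Carrier) → (∀ i → f i ≈ 0#) → sumFin R f ≈ 0#
  sumFin-zero {zero}  f p = refl
  sumFin-zero {suc n} f p = trans (+-cong (p zero) (sumFin-zero (f ∘ suc) (p ∘ suc))) (+-identityˡ 0#)

  sumFin-neg : (f : Fin n → Carrier) → sumFin R (λ i → - f i) ≈ - sumFin R f
  sumFin-neg {zero}  f = sym -0#≈0#
  sumFin-neg {suc n} f = trans (+-congˡ (sumFin-neg (f ∘ suc))) (-‿+-comm _ _)

  sumFin-linear : ∀ s t (f g h : Fin n → Carrier) → (∀ i → f i ≈ s * g i + t * h i) →
                  sumFin R f ≈ s * sumFin R g + t * sumFin R h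
  sumFin-linear {n} s t f g h p = begin
    sumFin R f                                           ≈⟨ sumFin-cong p ⟩
    sumFin R (λ i → s * g i + t * h i)                   ≈⟨ sumFin-+ {n} (λ i → s * g i) (λ i → t * h i) ⟩
    sumFin R (λ i → s * g i) + sumFin R (λ i → t * h i)  ≈⟨ +-cong (*-distribˡ-sumFin s g) (*-distribˡ-sumFin t h) ⟨
    s * sumFin R g + t * sumFin R h                      ∎

  sumFin-δ : (f : Fin n → Carrier) (k : Fin n) → sumFin R (λ r → f r * δ R r k) ≈ f k
  sumFin-δ {suc n} f zero    = trans (+-cong (*-identityʳ _) rest≈0) (+-identityʳ _)
    where
    rest≈0 : sumFin R (λ r → f (suc r) * δ R (suc r) zero) ≈ 0#
    rest≈0 = sumFin-zero _ (λ r → zeroʳ (f (suc r)))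
  sumFin-δ {suc n} f (suc k) = trans (+-cong (zeroʳ _) (sumFin-δ (f ∘ suc) k)) (+-identityˡ _)

  sumFin-snoc : ∀ n (f : ℕ → Carrier) → sumFin R {suc n} (f ∘ toℕ) ≈ sumFin R {n} (f ∘ toℕ) + f n
  sumFin-snoc n f rewrite sumFin≡sum {suc n} (f ∘ toℕ) | sumFin≡sum {n} (f ∘ toℕ) = begin
    sum {suc n} (f ∘ toℕ)                                    ≈⟨ sum-init-last (f ∘ toℕ) ⟩
    sum {n} (λ r → f (toℕ (inject₁ r))) + f (toℕ (fromℕ n))  ≈⟨ +-cong (sum-cong-≋ {n} (reflexive ∘ ≡.cong f ∘ toℕ-inject₁))
                                                                        (reflexive (≡.cong f (toℕ-fromℕ n))) ⟩
    sum {n} (f ∘ toℕ) + f n                                  ∎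

  infix 9 _·_

  _·_ : (Fin n → Carrier) → (Fin n → Carrier) → Carrier
  v · w = sumFin R (λ r → v r * w r)

module Determinant {c ℓ : Level} (R : CommutativeRing c ℓ) where

  open import Data.Nat as ℕ using (ℕ; zero; suc; _<ᵇ_)
  import Data.Nat.Properties as ℕ
  open import Data.Bool using (true; false; if_then_else_)
  open import Data.Fin using (Fin; zero; suc; punchIn; lift; toℕ; fromℕ<)
  open import Data.Fin.Properties using (suc-injective; toℕ-injective; toℕ-fromℕ<)
  open import Data.Integer using (0ℤ; 1ℤ)
  open import Data.Product using (_,_)
  open import Data.Empty using (⊥-elim)
  open import Function using (_∘_)
  open import Data.Vec.Functional using (updateAt)
  open import Data.Vec.Functional.Properties using (updateAt-updates; updateAt-minimal)
  open import Relation.Binary.PropositionalEquality as ≡ using (_≡_; _≢_)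

  open CommutativeRing R hiding (zero)
  open import Algebra.Properties.Ring ring using (-0#≈0#; -‿distribˡ-*)
  open Summation R
  open import Algebra.Properties.Monoid.Sum *-monoid using () renaming (sum to product)
  open IntegerCoefficients R using (solve; con; _:+_; _:*_; :-_; _:-_)
  open import Relation.Binary.Reasoning.Setoid setoid

  Row : ℕ → Set c
  Row n = Fin n → Carrier

  Matrix : ℕ → Set c
  Matrix n = Fin n → Row n

  private
    variable
      m n : ℕ

  minor : Matrix (suc n) → Fin (suc n) → Matrix n
  minor M j r k = M (suc r) (punchIn j k)

  _I-_ : Carrier → Matrix n → Matrix n
  (x I- H) j k = x * δ R j k - H j k

  expansionTerm : Matrix (suc n) → Fin (suc n) → Carrier
  expansionTerm M j = signFin R j * (M zero j * det R (minor M j))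

  det-cong : {M N : Matrix n} → (∀ r k → M r k ≈ N r k) → det R M ≈ det R N
  det-cong {zero}  p = refl
  det-cong {suc n} p =
    sumFin-cong λ j → *-congˡ {signFin R j} (*-cong (p zero j) (det-cong λ r k → p (suc r) (punchIn j k)))

  det-linear : (M N Q : Matrix n) (i : Fin n) (s t : Carrier) →
               (∀ r → r ≢ i → ∀ k → M r k ≈ N r k) →
               (∀ r → r ≢ i → ∀ k → M r k ≈ Q r k) →
               (∀ k → M i k ≈ s * N i k + t * Q i k) →
               det R M ≈ s * det R N + t * det R Q
  det-linear {suc n} M N Q zero s t M≈N M≈Q Mᵢ≈ = sumFin-linear s t _ _ _ λ j → begin
    signFin R j * (M zero j * det R (minor M j))
      ≈⟨ *-congˡ (*-cong (Mᵢ≈ j) refl) ⟩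
    signFin R j * ((s * N zero j + t * Q zero j) * det R (minor M j))
      ≈⟨ distribute (signFin R j) s t (N zero j) (Q zero j) (det R (minor M j)) ⟩
    s * (signFin R j * (N zero j * det R (minor M j))) + t * (signFin R j * (Q zero j * det R (minor M j)))
      ≈⟨ +-cong (*-congˡ (*-congˡ (*-congˡ (det-cong (λ r → M≈N (suc r) (λ ()) ∘ punchIn j)))))
                (*-congˡ (*-congˡ (*-congˡ (det-cong (λ r → M≈Q (suc r) (λ ()) ∘ punchIn j))))) ⟩
    s * (signFin R j * (N zero j * det R (minor N j))) + t * (signFin R j * (Q zero j * det R (minor Q j)))  ∎
    where
    distribute : ∀ σ s t a b d → σ * ((s * a + t * b) * d) ≈ s * (σ * (a * d)) + t * (σ * (b * d))
    distribute = solve 6 (λ σ s t a b d →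
      σ :* ((s :* a :+ t :* b) :* d) , s :* (σ :* (a :* d)) :+ t :* (σ :* (b :* d))) refl
  det-linear {suc n} M N Q (suc i) s t M≈N M≈Q Mᵢ≈ = sumFin-linear s t _ _ _ λ j → begin
    signFin R j * (M zero j * det R (minor M j))
      ≈⟨ *-congˡ (*-congˡ (det-linear (minor M j) (minor N j) (minor Q j) i s t
           (λ r r≢i → M≈N (suc r) (r≢i ∘ suc-injective) ∘ punchIn j)
           (λ r r≢i → M≈Q (suc r) (r≢i ∘ suc-injective) ∘ punchIn j)
           (Mᵢ≈ ∘ punchIn j))) ⟩
    signFin R j * (M zero j * (s * det R (minor N j) + t * det R (minor Q j)))
      ≈⟨ distribute (signFin R j) s t (M zero j) (det R (minor N j)) (det R (minor Q j)) ⟩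
    s * (signFin R j * (M zero j * det R (minor N j))) + t * (signFin R j * (M zero j * det R (minor Q j)))
      ≈⟨ +-cong (*-congˡ (*-congˡ (*-congʳ (M≈N zero (λ ()) j))))
                (*-congˡ (*-congˡ (*-congʳ (M≈Q zero (λ ()) j)))) ⟩
    s * (signFin R j * (N zero j * det R (minor N j))) + t * (signFin R j * (Q zero j * det R (minor Q j)))  ∎
    where
    distribute : ∀ σ s t a x y → σ * (a * (s * x + t * y)) ≈ s * (σ * (a * x)) + t * (σ * (a * y))
    distribute = solve 6 (λ σ s t a x y →
      σ :* (a :* (s :* x :+ t :* y)) , s :* (σ :* (a :* x)) :+ t :* (σ :* (a :* y))) refl

  PointwiseRespecting : ∀ {m n} → ((Fin m → Fin n) → Carrier) → Set ℓ
  PointwiseRespecting D = ∀ {h h′} → (∀ i → h i ≡ h′ i) → D h ≈ D h′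

  Minors : ℕ → Set c
  Minors m = (Fin m → Fin (suc (suc m))) → Carrier

  -- expand₂ a b D is the Laplace expansion along two rows a and b, D h standing for the
  -- determinant of the remaining rows restricted to the columns h.
  expand₂ : (a b : Row (suc (suc m))) → Minors m → Carrier
  expand₂ a b D = sumFin R λ j → signFin R j *
    (a j * sumFin R λ k → signFin R k * (b (punchIn j k) * D (punchIn j ∘ punchIn k)))

  private
    expandTail : Row (suc (suc m)) → Minors m → Carrier
    expandTail a D = sumFin R λ j → signFin R j * (a (suc j) * D (suc ∘ punchIn j))

    expand₂Rest : (a b : Row (suc (suc m))) → Minors m → Carrier
    expand₂Rest a b D = sumFin R λ j → signFin R j * (a (suc j) *
      sumFin R λ k → signFin R k * (b (suc (punchIn j k)) * D (punchIn (suc j) ∘ punchIn (suc k))))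

    -- The terms in which row a or row b uses column 0 are taken out.
    expand₂-split : (a b : Row (suc (suc m))) (D : Minors m) →
      expand₂ a b D ≈ 1# * (a zero * expandTail b D) + (- (b zero * expandTail a D) + expand₂Rest a b D)
    expand₂-split {m} a b D = +-congˡ (begin
      sumFin R lhs                                                  ≈⟨ sumFin-cong {f = lhs} {g = rhs} regroupTerm ⟩
      sumFin R rhs                                                  ≈⟨ sumFin-+ (λ j → - (b zero * tailTerm j)) restTerm ⟩
      sumFin R (λ j → - (b zero * tailTerm j)) + expand₂Rest a b D  ≈⟨ +-congʳ (sumFin-neg (λ j → b zero * tailTerm j)) ⟩
      - sumFin R (λ j → b zero * tailTerm j) + expand₂Rest a b D    ≈⟨ +-congʳ (-‿cong (*-distribˡ-sumFin (b zero) tailTerm)) ⟨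
      - (b zero * expandTail a D) + expand₂Rest a b D               ∎)
      where
      inner : Fin (suc m) → Fin m → Carrier
      inner j k = b (suc (punchIn j k)) * D (punchIn (suc j) ∘ punchIn (suc k))
      innerTerm : Fin (suc m) → Fin m → Carrier
      innerTerm j k = signFin R k * inner j k
      tailTerm restTerm lhs rhs : Fin (suc m) → Carrier
      tailTerm j = signFin R j * (a (suc j) * D (suc ∘ punchIn j))
      restTerm j = signFin R j * (a (suc j) * sumFin R (innerTerm j))
      lhs j = - signFin R j * (a (suc j) * (1# * (b zero * D (suc ∘ punchIn j))
                                            + sumFin R (λ k → - signFin R k * inner j k)))
      rhs j = - (b zero * tailTerm j) + restTerm j
      negate : ∀ j → sumFin R (λ k → - signFin R k * inner j k) ≈ - sumFin R (innerTerm j)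
      negate j = trans (sumFin-cong {m} λ k → sym (-‿distribˡ-* (signFin R k) _)) (sumFin-neg (innerTerm j))
      regroup : ∀ s a b d t → - s * (a * (1# * (b * d) + - t)) ≈ - (b * (s * (a * d))) + s * (a * t)
      regroup = solve 5 (λ s a b d t →
        (:- s) :* (a :* (con 1ℤ :* (b :* d) :+ :- t)) , :- (b :* (s :* (a :* d))) :+ s :* (a :* t)) refl
      regroupTerm : ∀ j → lhs j ≈ rhs j
      regroupTerm j = trans (*-congˡ (*-congˡ (+-congˡ (negate j))))
        (regroup (signFin R j) (a (suc j)) (b zero) (D (suc ∘ punchIn j)) (sumFin R (innerTerm j)))

    expand₂Rest-zero : (a b : Row 2) (D : Minors 0) → expand₂Rest a b D ≈ 0#
    expand₂Rest-zero a b D = trans (+-congʳ (trans (*-congˡ (zeroʳ _)) (zeroʳ _))) (+-identityʳ 0#)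

    expand₂Rest-suc : (a b : Row (suc (suc (suc m)))) (D : Minors (suc m)) → PointwiseRespecting D →
                      expand₂Rest a b D ≈ expand₂ (a ∘ suc) (b ∘ suc) (D ∘ lift 1)
    expand₂Rest-suc {m} a b D resp = sumFin-cong {f = outer restInner} {g = outer liftInner} λ j →
      *-congˡ (*-congˡ (sumFin-cong {f = restInner j} {g = liftInner j} λ k →
        *-congˡ (*-congˡ (resp λ { zero → ≡.refl ; (suc i) → ≡.refl }))))
      where
      restInner liftInner : Fin (suc (suc m)) → Fin (suc m) → Carrier
      restInner j k = signFin R k * (b (suc (punchIn j k)) * D (punchIn (suc j) ∘ punchIn (suc k)))
      liftInner j k = signFin R k * (b (suc (punchIn j k)) * D (lift 1 (punchIn j ∘ punchIn k)))
      outer : (Fin (suc (suc m)) → Fin (suc m) → Carrier) → Fin (suc (suc m)) → Carrier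
      outer inner j = signFin R j * (a (suc j) * sumFin R (inner j))

    lift-respecting : (D : Minors (suc m)) →
                      PointwiseRespecting D → PointwiseRespecting (D ∘ lift 1)
    lift-respecting D resp h≗h′ = resp λ { zero → ≡.refl ; (suc i) → ≡.cong suc (h≗h′ i) }

    anti-from-rest : (a b : Row (suc (suc m))) (D : Minors m) →
                     expand₂Rest a b D ≈ - expand₂Rest b a D → expand₂ a b D ≈ - expand₂ b a D
    anti-from-rest a b D rest-anti = begin
      expand₂ a b D                                                   ≈⟨ expand₂-split a b D ⟩
      1# * (a zero * tb) + (- (b zero * ta) + expand₂Rest a b D)      ≈⟨ +-congˡ (+-congˡ rest-anti) ⟩
      1# * (a zero * tb) + (- (b zero * ta) + - expand₂Rest b a D)    ≈⟨ swap (a zero * tb) (b zero * ta) _ ⟩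
      - (1# * (b zero * ta) + (- (a zero * tb) + expand₂Rest b a D))  ≈⟨ -‿cong (expand₂-split b a D) ⟨
      - expand₂ b a D                                                 ∎
      where
      ta = expandTail a D
      tb = expandTail b D
      swap : ∀ u v r → 1# * u + (- v + - r) ≈ - (1# * v + (- u + r))
      swap = solve 3 (λ u v r → con 1ℤ :* u :+ (:- v :+ :- r) , :- (con 1ℤ :* v :+ (:- u :+ r))) refl

    zero-from-rest : (a b : Row (suc (suc m))) (D : Minors m) →
                     (∀ k → a k ≈ b k) → expand₂Rest a b D ≈ 0# → expand₂ a b D ≈ 0#
    zero-from-rest {m} a b D a≈b rest≈0 = begin
      expand₂ a b D                                                        ≈⟨ expand₂-split a b D ⟩
      1# * (a zero * expandTail b D) + (- (b zero * expandTail a D) + expand₂Rest a b D)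
        ≈⟨ +-cong (*-congˡ (*-cong (a≈b zero) tails)) (+-congˡ rest≈0) ⟩
      1# * (b zero * expandTail a D) + (- (b zero * expandTail a D) + 0#)  ≈⟨ cancel _ ⟩
      0#                                                                   ∎
      where
      tailTerm : Row (suc (suc m)) → Fin (suc m) → Carrier
      tailTerm c j = signFin R j * (c (suc j) * D (suc ∘ punchIn j))
      tails : expandTail b D ≈ expandTail a D
      tails = sumFin-cong {f = tailTerm b} {g = tailTerm a} λ j → *-congˡ (*-congʳ (sym (a≈b (suc j))))
      cancel : ∀ v → 1# * v + (- v + 0#) ≈ 0#
      cancel = solve 1 (λ v → con 1ℤ :* v :+ (:- v :+ con 0ℤ) , con 0ℤ) refl

  expand₂-anti : (a b : Row (suc (suc m))) (D : Minors m) →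
                 PointwiseRespecting D → expand₂ a b D ≈ - expand₂ b a D
  expand₂-anti {zero} a b D resp = anti-from-rest a b D
    (trans (expand₂Rest-zero a b D) (trans (sym -0#≈0#) (-‿cong (sym (expand₂Rest-zero b a D)))))
  expand₂-anti {suc m} a b D resp = anti-from-rest a b D (trans (expand₂Rest-suc a b D resp) (trans
    (expand₂-anti (a ∘ suc) (b ∘ suc) (D ∘ lift 1) (lift-respecting D resp))
    (-‿cong (sym (expand₂Rest-suc b a D resp)))))

  expand₂-equal : (a b : Row (suc (suc m))) (D : Minors m) →
                  PointwiseRespecting D → (∀ k → a k ≈ b k) → expand₂ a b D ≈ 0#
  expand₂-equal {zero}  a b D resp a≈b = zero-from-rest a b D a≈b (expand₂Rest-zero a b D)
  expand₂-equal {suc m} a b D resp a≈b = zero-from-rest a b D a≈b (trans (expand₂Rest-suc a b D resp)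
    (expand₂-equal (a ∘ suc) (b ∘ suc) (D ∘ lift 1) (lift-respecting D resp) (a≈b ∘ suc)))

  private
    lowerRows : Matrix (suc (suc n)) → Minors n
    lowerRows M h = det R (λ r k → M (suc (suc r)) (h k))

    lowerRows-respecting : (M : Matrix (suc (suc n))) → PointwiseRespecting (lowerRows M)
    lowerRows-respecting M h≗h′ = det-cong (λ r k → reflexive (≡.cong (M (suc (suc r))) (h≗h′ k)))

    swapRows₀₁ : Matrix (suc (suc n)) → Matrix (suc (suc n))
    swapRows₀₁ M zero          = M (suc zero)
    swapRows₀₁ M (suc zero)    = M zero
    swapRows₀₁ M (suc (suc r)) = M (suc (suc r))

    det-swapRows₀₁ : (M : Matrix (suc (suc n))) → det R M ≈ - det R (swapRows₀₁ M)
    det-swapRows₀₁ M = expand₂-anti (M zero) (M (suc zero)) (lowerRows M) (lowerRows-respecting M)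

  det-equal-rows : (M : Matrix n) (i l : Fin n) → i ≢ l → (∀ k → M i k ≈ M l k) → det R M ≈ 0#

  private
    det-equal-rows-suc : (M : Matrix (suc n)) (i l : Fin n) → i ≢ l →
                         (∀ k → M (suc i) k ≈ M (suc l) k) → det R M ≈ 0#
    det-equal-rows-suc M i l i≢l Mᵢ≈Mₗ = sumFin-zero _ λ j → begin
      signFin R j * (M zero j * det R (minor M j))
        ≈⟨ *-congˡ (*-congˡ (det-equal-rows (minor M j) i l i≢l (Mᵢ≈Mₗ ∘ punchIn j))) ⟩
      signFin R j * (M zero j * 0#)                 ≈⟨ *-congˡ (zeroʳ _) ⟩
      signFin R j * 0#                              ≈⟨ zeroʳ _ ⟩
      0#                                            ∎

    det-equal-row₀ : (M : Matrix (suc n)) (l : Fin n) → (∀ k → M zero k ≈ M (suc l) k) →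
                     det R M ≈ 0#
    det-equal-row₀ {suc n} M zero    M₀≈M₁ =
      expand₂-equal (M zero) (M (suc zero)) (lowerRows M) (lowerRows-respecting M) M₀≈M₁
    det-equal-row₀ {suc (suc n)} M (suc l) M₀≈Mₗ = begin
      det R M                       ≈⟨ det-swapRows₀₁ M ⟩
      - det R (swapRows₀₁ M)        ≈⟨ -‿cong (det-equal-rows-suc (swapRows₀₁ M) zero (suc l) (λ ()) M₀≈Mₗ) ⟩
      - 0#                          ≈⟨ -0#≈0# ⟩
      0#                            ∎

  det-equal-rows M zero    zero    i≢l _     = ⊥-elim (i≢l ≡.refl)
  det-equal-rows M zero    (suc l) _   M₀≈Mₗ = det-equal-row₀ M l M₀≈Mₗ
  det-equal-rows M (suc i) zero    _   Mᵢ≈M₀ = det-equal-row₀ M i (sym ∘ Mᵢ≈M₀)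
  det-equal-rows M (suc i) (suc l) i≢l Mᵢ≈Mₗ = det-equal-rows-suc M i l (i≢l ∘ ≡.cong suc) Mᵢ≈Mₗ

  private
    replaceRow : Matrix n → Fin n → Row n → Matrix n
    replaceRow M i v = updateAt M i (λ _ → v)

    replaceRow-updates : (M : Matrix n) (i : Fin n) (v : Row n) → ∀ k → replaceRow M i v i k ≈ v k
    replaceRow-updates M i v k = reflexive (≡.cong-app (updateAt-updates i M) k)

    replaceRow-minimal : (M : Matrix n) (i : Fin n) (v : Row n) →
                         ∀ r → r ≢ i → ∀ k → replaceRow M i v r k ≈ M r k
    replaceRow-minimal M i v r r≢i k = reflexive (≡.cong-app (updateAt-minimal r i M r≢i) k)

  det-zero-row : (M : Matrix n) (i : Fin n) → (∀ k → M i k ≈ 0#) → det R M ≈ 0#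
  det-zero-row M i Mᵢ≈0 = trans
    (det-linear M M M i 0# 0# (λ _ _ _ → refl) (λ _ _ _ → refl) λ k → trans (Mᵢ≈0 k) (sym (annihilate _ _)))
    (annihilate _ _)
    where
    annihilate : ∀ x y → 0# * x + 0# * y ≈ 0#
    annihilate x y = trans (+-cong (zeroˡ x) (zeroˡ y)) (+-identityˡ 0#)

  det-dependent-row : (M : Matrix n) (i : Fin n) (g : Fin m → Fin n) (t : Row m) → (∀ r → g r ≢ i) →
                        (∀ k → M i k ≈ sumFin R (λ r → t r * M (g r) k)) → det R M ≈ 0#
  det-dependent-row {m = zero}  M i g t g≢i Mᵢ≈ = det-zero-row M i Mᵢ≈
  det-dependent-row {m = suc m} M i g t g≢i Mᵢ≈ = begin
    det R M                                  ≈⟨ det-linear M S Q i (t zero) 1# (λ r r≢i → sym ∘ replaceRow-minimal M i _ r r≢i)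
                                                  (λ r r≢i → sym ∘ replaceRow-minimal M i _ r r≢i) split ⟩
    t zero * det R S + 1# * det R Q          ≈⟨ +-cong (*-congˡ det-S) (*-congˡ det-Q) ⟩
    t zero * 0# + 1# * 0#                    ≈⟨ trans (+-cong (zeroʳ _) (zeroʳ _)) (+-identityˡ 0#) ⟩
    0#                                       ∎
    where
    v : Row _
    v k = sumFin R (λ r → t (suc r) * M (g (suc r)) k)
    S Q : Matrix _
    S = replaceRow M i (M (g zero))
    Q = replaceRow M i v
    split : ∀ k → M i k ≈ t zero * S i k + 1# * Q i k
    split k = trans (Mᵢ≈ k) (+-cong (*-congˡ (sym (replaceRow-updates M i _ k)))
                                    (trans (sym (*-identityˡ _)) (*-congˡ (sym (replaceRow-updates M i v k)))))
    det-S : det R S ≈ 0#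
    det-S = det-equal-rows S i (g zero) (g≢i zero ∘ ≡.sym) λ k →
      trans (replaceRow-updates M i _ k) (sym (replaceRow-minimal M i _ (g zero) (g≢i zero) k))
    det-Q : det R Q ≈ 0#
    det-Q = det-dependent-row Q i (g ∘ suc) (t ∘ suc) (g≢i ∘ suc) λ k →
      trans (replaceRow-updates M i v k)
            (sumFin-cong λ r → *-congˡ (sym (replaceRow-minimal M i v (g (suc r)) (g≢i (suc r)) k)))

  det-add-combination : (M N : Matrix n) (i : Fin n) (g : Fin m → Fin n) (t : Row m) → (∀ r → g r ≢ i) →
                        (∀ r → r ≢ i → ∀ k → N r k ≈ M r k) →
                        (∀ k → N i k ≈ M i k + sumFin R (λ r → t r * M (g r) k)) → det R N ≈ det R M
  det-add-combination M N i g t g≢i N≈M Nᵢ≈ = begin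
    det R N
      ≈⟨ det-linear N M Q i 1# 1# N≈M (λ r r≢i k → trans (N≈M r r≢i k) (sym (replaceRow-minimal M i v r r≢i k))) split ⟩
    1# * det R M + 1# * det R Q   ≈⟨ +-cong (*-identityˡ _) (trans (*-identityˡ _) det-Q) ⟩
    det R M + 0#                  ≈⟨ +-identityʳ _ ⟩
    det R M                       ∎
    where
    v : Row _
    v k = sumFin R (λ r → t r * M (g r) k)
    Q : Matrix _
    Q = replaceRow M i v
    split : ∀ k → N i k ≈ 1# * M i k + 1# * Q i k
    split k = trans (Nᵢ≈ k) (+-cong (sym (*-identityˡ _))
                                    (trans (sym (*-identityˡ _)) (*-congˡ (sym (replaceRow-updates M i v k)))))
    det-Q : det R Q ≈ 0#
    det-Q = det-dependent-row Q i g t g≢i λ k →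
      trans (replaceRow-updates M i v k)
            (sumFin-cong λ r → *-congˡ (sym (replaceRow-minimal M i v (g r) (g≢i r) k)))

  private
    <ᵇ-suc : ∀ a m → a ≢ m → (a <ᵇ suc m) ≡ (a <ᵇ m)
    <ᵇ-suc zero    zero    a≢m = ⊥-elim (a≢m ≡.refl)
    <ᵇ-suc zero    (suc m) _   = ≡.refl
    <ᵇ-suc (suc a) zero    _   = ≡.refl
    <ᵇ-suc (suc a) (suc m) a≢m = <ᵇ-suc a m (a≢m ∘ ≡.cong suc)

    n<ᵇ1+n : ∀ m → (m <ᵇ suc m) ≡ true
    n<ᵇ1+n zero    = ≡.refl
    n<ᵇ1+n (suc m) = n<ᵇ1+n m

    n<ᵇn : ∀ m → (m <ᵇ m) ≡ false
    n<ᵇn zero    = ≡.refl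
    n<ᵇn (suc m) = n<ᵇn m

    toℕ<ᵇn : (r : Fin n) → (toℕ r <ᵇ n) ≡ true
    toℕ<ᵇn zero    = ≡.refl
    toℕ<ᵇn (suc r) = toℕ<ᵇn r

    module LowerRowAddition (M : Matrix (suc (suc n))) (f g : Row n) where

      added : Fin n → Row (suc (suc n))
      added r k = M (suc (suc r)) k + (f r * M zero k + g r * M (suc zero) k)

      -- The first m of the rows below row 1 have received their addition.
      partial : ℕ → Matrix (suc (suc n))
      partial m zero          = M zero
      partial m (suc zero)    = M (suc zero)
      partial m (suc (suc r)) = if toℕ r <ᵇ m then added r else M (suc (suc r))

      partial-step : ∀ m → m ℕ.< n → det R (partial (suc m)) ≈ det R (partial m)
      partial-step m m<n = det-add-combination (partial m) (partial (suc m)) (suc (suc r₀)) source coefficient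
          (λ { zero () ; (suc zero) () }) unchanged changed
        where
        r₀ : Fin n
        r₀ = fromℕ< m<n
        at-r₀ : ∀ {r} → toℕ r ≡ m → r ≡ r₀
        at-r₀ r≡m = toℕ-injective (≡.trans r≡m (≡.sym (toℕ-fromℕ< m<n)))
        source : Fin 2 → Fin (suc (suc n))
        source zero = zero
        source (suc zero) = suc zero
        coefficient : Fin 2 → Carrier
        coefficient zero = f r₀
        coefficient (suc zero) = g r₀
        unchanged : ∀ r → r ≢ suc (suc r₀) → ∀ k → partial (suc m) r k ≈ partial m r k
        unchanged zero          _     k = refl
        unchanged (suc zero)    _     k = refl
        unchanged (suc (suc r)) r≢r₀ k
          rewrite <ᵇ-suc (toℕ r) m (r≢r₀ ∘ ≡.cong (λ r → suc (suc r)) ∘ at-r₀) = refl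
        changed : ∀ k → partial (suc m) (suc (suc r₀)) k ≈
                        partial m (suc (suc r₀)) k + sumFin R (λ s → coefficient s * partial m (source s) k)
        changed k rewrite toℕ-fromℕ< m<n | n<ᵇ1+n m | n<ᵇn m = +-congˡ (+-congˡ (sym (+-identityʳ _)))

      partial-all : ∀ m → m ℕ.≤ n → det R (partial m) ≈ det R M
      partial-all zero    _   = det-cong {M = partial zero} {N = M} λ
        { zero k → refl ; (suc zero) k → refl ; (suc (suc r)) k → refl }
      partial-all (suc m) m<n = trans (partial-step m m<n) (partial-all m (ℕ.<⇒≤ m<n))

  det-add-to-lower-rows : (M N : Matrix (suc (suc n))) (f g : Row n) →
    (∀ k → N zero k ≈ M zero k) → (∀ k → N (suc zero) k ≈ M (suc zero) k) →
    (∀ r k → N (suc (suc r)) k ≈ M (suc (suc r)) k + (f r * M zero k + g r * M (suc zero) k)) →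
    det R N ≈ det R M
  det-add-to-lower-rows {n} M N f g N₀≈ N₁≈ N₂₊≈ = trans (det-cong N≈partial) (partial-all n ℕ.≤-refl)
    where
    open LowerRowAddition M f g
    N≈partial : ∀ r k → N r k ≈ partial n r k
    N≈partial zero          = N₀≈
    N≈partial (suc zero)    = N₁≈
    N≈partial (suc (suc r)) k rewrite toℕ<ᵇn r = N₂₊≈ r k

  det-scale-rows : (d : Row n) (Z : Matrix n) → det R (λ r k → d r * Z r k) ≈ product d * det R Z
  det-scale-rows {zero}  d Z = sym (*-identityˡ 1#)
  det-scale-rows {suc n} d Z = trans
    (sumFin-cong {f = expansionTerm (λ r k → d r * Z r k)} {g = λ j → factor * expansionTerm Z j} λ j →
      trans (*-congˡ (*-congˡ (det-scale-rows (d ∘ suc) (minor Z j))))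
            (rearrange (signFin R j) (d zero) (Z zero j) (product (d ∘ suc)) (det R (minor Z j))))
    (sym (*-distribˡ-sumFin factor (expansionTerm Z)))
    where
    factor = d zero * product (d ∘ suc)
    rearrange : ∀ s d₀ z p D → s * ((d₀ * z) * (p * D)) ≈ (d₀ * p) * (s * (z * D))
    rearrange = solve 5 (λ s d₀ z p D → s :* ((d₀ :* z) :* (p :* D)) , (d₀ :* p) :* (s :* (z :* D))) refl

  det-expand-unit-row₀ : (M : Matrix (suc n)) → (∀ k → M zero (suc k) ≈ 0#) →
                         det R M ≈ M zero zero * det R (λ r k → M (suc r) (suc k))
  det-expand-unit-row₀ M M₀≈0 = begin
    1# * (M zero zero * det R (minor M zero)) + sumFin R (expansionTerm M ∘ suc)
      ≈⟨ +-cong (*-identityˡ _) (sumFin-zero _ λ j → trans (*-congˡ (trans (*-congʳ (M₀≈0 j)) (zeroˡ _))) (zeroʳ _)) ⟩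
    M zero zero * det R (minor M zero) + 0#
      ≈⟨ +-identityʳ _ ⟩
    M zero zero * det R (λ r k → M (suc r) (suc k))  ∎

  det-identity : (M : Matrix n) → (∀ r k → M r k ≈ δ R r k) → det R M ≈ 1#
  det-identity {zero}  M M≈δ = refl
  det-identity {suc n} M M≈δ = begin
    det R M                                            ≈⟨ det-expand-unit-row₀ M (M≈δ zero ∘ suc) ⟩
    M zero zero * det R (λ r k → M (suc r) (suc k))    ≈⟨ *-cong (M≈δ zero zero) (det-identity _ λ r k → M≈δ (suc r) (suc k)) ⟩
    1# * 1#                                            ≈⟨ *-identityˡ 1# ⟩
    1#                                                 ∎

  det-block-identity₂ : (M : Matrix (suc (suc n))) →
    (∀ k → M zero (suc (suc k)) ≈ 0#) → (∀ k → M (suc zero) (suc (suc k)) ≈ 0#) →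
    (∀ r k → M (suc (suc r)) (suc (suc k)) ≈ δ R r k) →
    det R M ≈ M zero zero * M (suc zero) (suc zero) - M zero (suc zero) * M (suc zero) zero
  det-block-identity₂ M M₀≈0 M₁≈0 M₂₂≈δ = begin
    1# * (M zero zero * det R (minor M zero))
      + (- 1# * (M zero (suc zero) * det R (minor M (suc zero)))
      + sumFin R (λ j → signFin R (suc (suc j)) * (M zero (suc (suc j)) * det R (minor M (suc (suc j))))))
      ≈⟨ +-cong (*-congˡ (*-congˡ lower₀)) (+-cong (*-congˡ (*-congˡ lower₁))
           (sumFin-zero _ λ j → trans (*-congˡ (trans (*-congʳ (M₀≈0 j)) (zeroˡ _))) (zeroʳ _))) ⟩
    1# * (M zero zero * (M (suc zero) (suc zero) * 1#))
      + (- 1# * (M zero (suc zero) * (M (suc zero) zero * 1#)) + 0#)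
      ≈⟨ collect _ _ _ _ ⟩
    M zero zero * M (suc zero) (suc zero) - M zero (suc zero) * M (suc zero) zero  ∎
    where
    lower₀ : det R (minor M zero) ≈ M (suc zero) (suc zero) * 1#
    lower₀ = trans (det-expand-unit-row₀ (minor M zero) M₁≈0) (*-congˡ (det-identity _ M₂₂≈δ))
    lower₁ : det R (minor M (suc zero)) ≈ M (suc zero) zero * 1#
    lower₁ = trans (det-expand-unit-row₀ (minor M (suc zero)) M₁≈0) (*-congˡ (det-identity _ M₂₂≈δ))
    collect : ∀ a b c d → 1# * (a * (d * 1#)) + (- 1# * (b * (c * 1#)) + 0#) ≈ a * d - b * c
    collect = solve 4 (λ a b c d →
      con 1ℤ :* (a :* (d :* con 1ℤ)) :+ ((:- con 1ℤ) :* (b :* (c :* con 1ℤ)) :+ con 0ℤ) , a :* d :- b :* c) refl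

  product-const : ∀ n (x : Carrier) → product {n} (λ _ → x) ≈ pow R x n
  product-const zero    x = refl
  product-const (suc n) x = *-congˡ (product-const n x)

  module _ (x : Carrier) (H : Matrix (suc (suc n))) (α β : Row n)
           (H₂₊≈ : ∀ r k → H (suc (suc r)) k ≈ α r * H zero k + β r * H (suc zero) k) where

    private
      a b : Row (suc (suc n))
      a = H zero
      b = H (suc zero)

      a₂₊ b₂₊ : Row n
      a₂₊ r = a (suc (suc r))
      b₂₊ r = b (suc (suc r))

      -- Subtracting α r times row 0 and β r times row 1 from row 2 + r of x I - H leaves x times
      -- row 2 + r of Z.
      Z : Matrix (suc (suc n))
      Z zero          k = x * δ R zero k - a k
      Z (suc zero)    k = x * δ R (suc zero) k - b k
      Z (suc (suc r)) k = δ R (suc (suc r)) k - α r * δ R zero k - β r * δ R (suc zero) k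

      lower : Row n → Row (suc (suc n))
      lower c k = sumFin R (λ r → c r * Z (suc (suc r)) k)

      lower-0 : ∀ c → lower c zero ≈ - (c · α)
      lower-0 c = trans (sumFin-cong λ r → simplify (c r) (α r) (β r)) (sumFin-neg {n} _)
        where
        simplify : ∀ c α β → c * (0# - α * 1# - β * 0#) ≈ - (c * α)
        simplify = solve 3 (λ c α β → c :* (con 0ℤ :- α :* con 1ℤ :- β :* con 0ℤ) , :- (c :* α)) refl

      lower-1 : ∀ c → lower c (suc zero) ≈ - (c · β)
      lower-1 c = trans (sumFin-cong λ r → simplify (c r) (α r) (β r)) (sumFin-neg {n} _)
        where
        simplify : ∀ c α β → c * (0# - α * 0# - β * 1#) ≈ - (c * β)
        simplify = solve 3 (λ c α β → c :* (con 0ℤ :- α :* con 0ℤ :- β :* con 1ℤ) , :- (c :* β)) refl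

      Z₂₂≈δ : ∀ r k → Z (suc (suc r)) (suc (suc k)) ≈ δ R r k
      Z₂₂≈δ r k = simplify (δ R r k) (α r) (β r)
        where
        simplify : ∀ d α β → d - α * 0# - β * 0# ≈ d
        simplify = solve 3 (λ d α β → d :- α :* con 0ℤ :- β :* con 0ℤ , d) refl

      lower-2 : ∀ c k → lower c (suc (suc k)) ≈ c k
      lower-2 c k = trans (sumFin-cong λ r → *-congˡ (Z₂₂≈δ r k)) (sumFin-δ c k)

      scale : Row (suc (suc n))
      scale zero          = 1#
      scale (suc zero)    = 1#
      scale (suc (suc r)) = x

      det-scaled : det R (x I- H) ≈ pow R x n * det R Z
      det-scaled = begin
        det R (x I- H)
          ≈⟨ det-add-to-lower-rows (x I- H) (λ r k → scale r * Z r k) (λ r → - α r) (λ r → - β r)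
               (λ k → *-identityˡ _) (λ k → *-identityˡ _) lowerRow ⟨
        det R (λ r k → scale r * Z r k)  ≈⟨ det-scale-rows scale Z ⟩
        product scale * det R Z          ≈⟨ *-congʳ (trans (*-identityˡ _) (trans (*-identityˡ _) (product-const n x))) ⟩
        pow R x n * det R Z              ∎
        where
        eliminate : ∀ x d d₀ d₁ α β a b →
          x * (d - α * d₀ - β * d₁) ≈ (x * d - (α * a + β * b)) + ((- α) * (x * d₀ - a) + (- β) * (x * d₁ - b))
        eliminate = solve 8 (λ x d d₀ d₁ α β a b →
          x :* (d :- α :* d₀ :- β :* d₁) ,
          (x :* d :- (α :* a :+ β :* b)) :+ ((:- α) :* (x :* d₀ :- a) :+ (:- β) :* (x :* d₁ :- b))) refl
        lowerRow : ∀ r k → x * Z (suc (suc r)) k ≈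
          (x I- H) (suc (suc r)) k + ((- α r) * (x I- H) zero k + (- β r) * (x I- H) (suc zero) k)
        lowerRow r k = trans (eliminate x _ _ _ (α r) (β r) (a k) (b k))
                             (+-congʳ (+-congˡ (-‿cong (sym (H₂₊≈ r k)))))

      -- Rows 0 and 1 of Z with their entries in columns 2, 3, … cleared by the rows below.
      Y₁ Y : Matrix (suc (suc n))
      Y₁ zero k = Z zero k + lower a₂₊ k
      Y₁ (suc r) k = Z (suc r) k
      Y zero k = Y₁ zero k
      Y (suc zero) k = Z (suc zero) k + lower b₂₊ k
      Y (suc (suc r)) k = Z (suc (suc r)) k

      det-cleared : det R Y ≈ det R Z
      det-cleared = trans
        (det-add-combination Y₁ Y (suc zero) (λ r → suc (suc r)) b₂₊ (λ r ())
          (λ { zero _ k → refl ; (suc zero) 1≢1 k → ⊥-elim (1≢1 ≡.refl) ; (suc (suc r)) _ k → refl }) (λ k → refl))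
        (det-add-combination Z Y₁ zero (λ r → suc (suc r)) a₂₊ (λ r ())
          (λ { zero 0≢0 k → ⊥-elim (0≢0 ≡.refl) ; (suc r) _ k → refl }) (λ k → refl))

    det-xI-minus-rank-two : det R (x I- H) ≈ pow R x n *
      ((x - H zero zero - (λ r → H zero (suc (suc r))) · α)
         * (x - H (suc zero) (suc zero) - (λ r → H (suc zero) (suc (suc r))) · β)
       - (H zero (suc zero) + (λ r → H zero (suc (suc r))) · β)
         * (H (suc zero) zero + (λ r → H (suc zero) (suc (suc r))) · α))
    det-xI-minus-rank-two = begin
      det R (x I- H)       ≈⟨ det-scaled ⟩
      pow R x n * det R Z  ≈⟨ *-congˡ det-cleared ⟨
      pow R x n * det R Y  ≈⟨ *-congˡ (det-block-identity₂ Y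
                                (λ k → trans (+-congˡ (lower-2 _ k)) (cancel x (a (suc (suc k)))))
                                (λ k → trans (+-congˡ (lower-2 _ k)) (cancel x (b (suc (suc k)))))
                                Z₂₂≈δ) ⟩
      pow R x n * (((x * 1# - a zero) + lower a₂₊ zero) * ((x * 1# - b (suc zero)) + lower b₂₊ (suc zero))
                   - ((x * 0# - a (suc zero)) + lower a₂₊ (suc zero)) * ((x * 0# - b zero) + lower b₂₊ zero))
        ≈⟨ *-congˡ (+-cong (*-cong (+-congˡ (lower-0 a₂₊)) (+-congˡ (lower-1 b₂₊)))
                           (-‿cong (*-cong (+-congˡ (lower-1 a₂₊)) (+-congˡ (lower-0 b₂₊))))) ⟩
      pow R x n * (((x * 1# - a zero) + - a₂₊ · α) * ((x * 1# - b (suc zero)) + - b₂₊ · β)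
                   - ((x * 0# - a (suc zero)) + - a₂₊ · β) * ((x * 0# - b zero) + - b₂₊ · α))
        ≈⟨ *-congˡ (tidy x (a zero) (b (suc zero)) (a (suc zero)) (b zero) _ _ _ _) ⟩
      pow R x n * ((x - a zero - a₂₊ · α) * (x - b (suc zero) - b₂₊ · β)
                   - (a (suc zero) + a₂₊ · β) * (b zero + b₂₊ · α)) ∎
      where
      tidy : ∀ x a₀ b₁ a₁ b₀ s t u v →
        ((x * 1# - a₀) + - s) * ((x * 1# - b₁) + - t) - ((x * 0# - a₁) + - u) * ((x * 0# - b₀) + - v)
        ≈ (x - a₀ - s) * (x - b₁ - t) - (a₁ + u) * (b₀ + v)
      tidy = solve 9 (λ x a₀ b₁ a₁ b₀ s t u v →
        ((x :* con 1ℤ :- a₀) :+ :- s) :* ((x :* con 1ℤ :- b₁) :+ :- t)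
          :- ((x :* con 0ℤ :- a₁) :+ :- u) :* ((x :* con 0ℤ :- b₀) :+ :- v) ,
        (x :- a₀ :- s) :* (x :- b₁ :- t) :- (a₁ :+ u) :* (b₀ :+ v)) refl
      cancel : ∀ x c → (x * 0# - c) + c ≈ 0#
      cancel = solve 2 (λ x c → (x :* con 0ℤ :- c) :+ c , con 0ℤ) refl

module Lucas {c ℓ : Level} (R : CommutativeRing c ℓ) (A : CommutativeRing.Carrier R) where

  open import Data.Nat as ℕ using (ℕ; zero; suc)
  open import Data.Nat.Properties using (+-suc)
  open import Data.Fin using (toℕ)
  open import Data.Integer using (0ℤ; 1ℤ)
  open import Data.Product using (_,_)
  open import Function using (_∘_)

  open CommutativeRing R hiding (zero)
  open Summation R using (sumFin-snoc)
  open IntegerCoefficients R using (solve; Polynomial; con; _:+_; _:*_; :-_; _:-_)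
  open import Relation.Binary.Reasoning.Setoid setoid

  u v : ℕ → Carrier
  u = lucasU R A (- 1#)
  v = lucasV R A (- 1#)

  u-cong : ∀ {m n} → m ≡ n → u m ≈ u n
  u-cong = reflexive ∘ ≡.cong u

  private
    -- The recurrence u (2 + m) = A u (1 + m) + u m, as a polynomial in A, u m and u (1 + m).
    next : ∀ {k} → Polynomial k → Polynomial k → Polynomial k → Polynomial k
    next a y z = a :* z :- (:- con 1ℤ) :* y

  u-add : ∀ m n → u (suc (m +ℕ n)) ≈ u (suc m) * u (suc n) + u m * u n
  u-add zero    n = solve 2 (λ y z → z , con 1ℤ :* z :+ con 0ℤ :* y) refl (u n) (u (suc n))
  u-add (suc m) n = begin
    u (suc (suc (m +ℕ n)))                        ≈⟨ u-cong (≡.cong suc (+-suc m n)) ⟨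
    u (suc (m +ℕ suc n))                          ≈⟨ u-add m (suc n) ⟩
    u (suc m) * u (suc (suc n)) + u m * u (suc n)  ≈⟨ shift A (u m) (u (suc m)) (u n) (u (suc n)) ⟩
    u (suc (suc m)) * u (suc n) + u (suc m) * u n  ∎
    where
    shift : ∀ a x₀ x₁ y₀ y₁ →
            x₁ * (a * y₁ - - 1# * y₀) + x₀ * y₁ ≈ (a * x₁ - - 1# * x₀) * y₁ + x₁ * y₀
    shift = solve 5 (λ a x₀ x₁ y₀ y₁ →
      x₁ :* next a y₀ y₁ :+ x₀ :* y₁ , next a x₀ x₁ :* y₁ :+ x₁ :* y₀) refl

  u-product-difference : ∀ m n → u (2 +ℕ m) * u (2 +ℕ n) - u m * u n ≈ A * u (2 +ℕ (m +ℕ n))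
  u-product-difference m n = begin
    u (2 +ℕ m) * u (2 +ℕ n) - u m * u n
      ≈⟨ difference _ _ _ ⟩
    ((u (2 +ℕ m) * u (2 +ℕ n) + Q) - Q) - ((Q + u m * u n) - Q)
      ≈⟨ +-cong (+-congʳ (sym outer)) (-‿cong (+-congʳ (sym (u-add m n)))) ⟩
    (u (3 +ℕ (m +ℕ n)) - Q) - (u (suc (m +ℕ n)) - Q)
      ≈⟨ collapse A _ _ _ ⟩
    A * u (2 +ℕ (m +ℕ n))  ∎
    where
    Q = u (suc m) * u (suc n)
    outer : u (3 +ℕ (m +ℕ n)) ≈ u (2 +ℕ m) * u (2 +ℕ n) + Q
    outer = trans (u-cong (≡.cong (suc ∘ suc) (≡.sym (+-suc m n)))) (u-add (suc m) (suc n))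
    difference : ∀ p s q → p - s ≈ ((p + q) - q) - ((q + s) - q)
    difference = solve 3 (λ p s q → p :- s , ((p :+ q) :- q) :- ((q :+ s) :- q)) refl
    collapse : ∀ a y z q → ((a * y - - 1# * z) - q) - (z - q) ≈ a * y
    collapse = solve 4 (λ a y z q → (next a z y :- q) :- (z :- q) , a :* y) refl

  cassini-even : ∀ q → let m = q ℕ.* 2 in u m * u (2 +ℕ m) - u (1 +ℕ m) * u (1 +ℕ m) ≈ - 1#
  cassini-even zero    =
    solve 1 (λ a → con 0ℤ :* next a (con 0ℤ) (con 1ℤ) :- con 1ℤ :* con 1ℤ , :- con 1ℤ) refl A
  cassini-even (suc q) = trans (two-steps A (u (q ℕ.* 2)) (u (1 +ℕ q ℕ.* 2))) (cassini-even q)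
    where
    two-steps : ∀ a y z → let w = a * z - - 1# * y ; w′ = a * w - - 1# * z in
                w * (a * w′ - - 1# * w) - w′ * w′ ≈ y * w - z * z
    two-steps = solve 3 (λ a y z → let w = next a y z ; w′ = next a z w in
                                   w :* next a w w′ :- w′ :* w′ , y :* w :- z :* z) refl

  v-as-u : ∀ m → v (suc m) ≈ u (suc (suc m)) + u m
  v-as-u zero          = solve 1 (λ a → a , next a (con 0ℤ) (con 1ℤ) :+ con 0ℤ) refl A
  v-as-u (suc zero)    = solve 1 (λ a →
    a :* a :- (:- con 1ℤ) :* (con 1ℤ :+ con 1ℤ) , next a (con 1ℤ) (next a (con 0ℤ) (con 1ℤ)) :+ con 1ℤ) refl A
  v-as-u (suc (suc m)) = begin
    A * v (suc (suc m)) - - 1# * v (suc m)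
      ≈⟨ +-cong (*-congˡ (v-as-u (suc m))) (-‿cong (*-congˡ (v-as-u m))) ⟩
    A * (u (3 +ℕ m) + u (suc m)) - - 1# * (u (2 +ℕ m) + u m)
      ≈⟨ regroup A _ _ _ _ ⟩
    u (4 +ℕ m) + u (2 +ℕ m)  ∎
    where
    regroup : ∀ a x₃ x₁ x₂ x₀ →
              a * (x₃ + x₁) - - 1# * (x₂ + x₀) ≈ (a * x₃ - - 1# * x₂) + (a * x₁ - - 1# * x₀)
    regroup = solve 5 (λ a x₃ x₁ x₂ x₀ →
      next a (x₂ :+ x₀) (x₃ :+ x₁) , next a x₂ x₃ :+ next a x₀ x₁) refl

  product-sum : ℕ → ℕ → ℕ → Carrier
  product-sum p s N = sumFin R {N} (λ r → u (4 +ℕ p +ℕ toℕ r) * u (1 +ℕ s +ℕ toℕ r))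

  -- Consecutive terms combine by u-add and the result telescopes by u-product-difference, so the
  -- closed form holds for an even number of terms.
  product-sum-even : ∀ p s q → A * (u (2 +ℕ (p +ℕ s)) + product-sum p s (q ℕ.* 2))
                               ≈ u (2 +ℕ q ℕ.* 2) * u (2 +ℕ (q ℕ.* 2 +ℕ (p +ℕ s)))
  product-sum-even p s zero    =
    solve 2 (λ a x → a :* (x :+ con 0ℤ) , next a (con 0ℤ) (con 1ℤ) :* x) refl A (u (2 +ℕ (p +ℕ s)))
  product-sum-even p s (suc q) = begin
    A * (u (2 +ℕ K) + product-sum p s (2 +ℕ N))
      ≈⟨ *-congˡ (+-congˡ (trans (sumFin-snoc (suc N) g) (+-congʳ (sumFin-snoc N g)))) ⟩
    A * (u (2 +ℕ K) + ((product-sum p s N + g N) + g (suc N)))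
      ≈⟨ regroup A _ _ _ _ ⟩
    A * (u (2 +ℕ K) + product-sum p s N) + A * (g N + g (suc N))
      ≈⟨ +-cong (product-sum-even p s q) (*-congˡ consecutive) ⟩
    u (2 +ℕ N) * u (2 +ℕ (N +ℕ K)) + A * u (2 +ℕ ((2 +ℕ N) +ℕ (2 +ℕ (N +ℕ K))))
      ≈⟨ +-congˡ (u-product-difference (2 +ℕ N) (2 +ℕ (N +ℕ K))) ⟨
    u (2 +ℕ N) * u (2 +ℕ (N +ℕ K))
      + (u (4 +ℕ N) * u (4 +ℕ (N +ℕ K)) - u (2 +ℕ N) * u (2 +ℕ (N +ℕ K)))
      ≈⟨ cancel _ _ ⟩
    u (4 +ℕ N) * u (4 +ℕ (N +ℕ K))  ∎
    where
    N = q ℕ.* 2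
    K = p +ℕ s
    g : ℕ → Carrier
    g r = u (4 +ℕ p +ℕ r) * u (1 +ℕ s +ℕ r)
    regroup : ∀ a x y z w → a * (x + ((y + z) + w)) ≈ a * (x + y) + a * (z + w)
    regroup = solve 5 (λ a x y z w → a :* (x :+ ((y :+ z) :+ w)) , a :* (x :+ y) :+ a :* (z :+ w)) refl
    cancel : ∀ x y → x + (y - x) ≈ y
    cancel = solve 2 (λ x y → x :+ (y :- x) , y) refl
    index : ∀ p s N → suc ((4 +ℕ p +ℕ N) +ℕ (1 +ℕ s +ℕ N))
                      ≡ 2 +ℕ ((2 +ℕ N) +ℕ (2 +ℕ (N +ℕ (p +ℕ s))))
    index = solve-∀
    consecutive : g N + g (suc N) ≈ u (2 +ℕ ((2 +ℕ N) +ℕ (2 +ℕ (N +ℕ K))))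
    consecutive = begin
      g N + g (suc N)
        ≈⟨ +-comm _ _ ⟩
      u (4 +ℕ p +ℕ suc N) * u (1 +ℕ s +ℕ suc N) + g N
        ≈⟨ +-congʳ (*-cong (u-cong (+-suc (4 +ℕ p) N)) (u-cong (+-suc (1 +ℕ s) N))) ⟩
      u (suc (4 +ℕ p +ℕ N)) * u (suc (1 +ℕ s +ℕ N)) + g N
        ≈⟨ u-add (4 +ℕ p +ℕ N) (1 +ℕ s +ℕ N) ⟨
      u (suc ((4 +ℕ p +ℕ N) +ℕ (1 +ℕ s +ℕ N)))
        ≈⟨ u-cong (index p s N) ⟩
      u (2 +ℕ ((2 +ℕ N) +ℕ (2 +ℕ (N +ℕ K))))  ∎

module Hankel {c ℓ : Level} (R : CommutativeRing c ℓ) (A : CommutativeRing.Carrier R) where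

  open import Data.Nat as ℕ using (ℕ; zero; suc)
  import Data.Nat.Properties as ℕ
  open import Data.Fin using (Fin; zero; suc; toℕ)
  open import Data.Integer using (1ℤ)
  open import Data.Product using (_,_)

  open CommutativeRing R hiding (zero)
  open IntegerCoefficients R using (solve; con; _:+_; _:*_; :-_; _:-_)
  open Determinant R using (Matrix; _I-_; det-xI-minus-rank-two)
  open Lucas R A
  open import Relation.Binary.Reasoning.Setoid setoid

  -- The paper's matrix (u (j + k)) for 1 ≤ j, k ≤ n, with rows and columns indexed from 0.
  hankel : ∀ {n} → Matrix n
  hankel j k = u (2 +ℕ (toℕ j +ℕ toℕ k))

  hankel-rank-two : ∀ {n} (r : Fin n) k →
    hankel (suc (suc r)) k ≈ u (1 +ℕ toℕ r) * hankel zero k + u (2 +ℕ toℕ r) * hankel (suc zero) k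
  hankel-rank-two r k = begin
    u (4 +ℕ (toℕ r +ℕ toℕ k))                                          ≈⟨ u-cong (index (toℕ r) (toℕ k)) ⟩
    u (suc ((1 +ℕ toℕ r) +ℕ (2 +ℕ toℕ k)))                             ≈⟨ u-add (1 +ℕ toℕ r) (2 +ℕ toℕ k) ⟩
    u (2 +ℕ toℕ r) * u (3 +ℕ toℕ k) + u (1 +ℕ toℕ r) * u (2 +ℕ toℕ k)  ≈⟨ +-comm _ _ ⟩
    u (1 +ℕ toℕ r) * u (2 +ℕ toℕ k) + u (2 +ℕ toℕ r) * u (3 +ℕ toℕ k)  ∎
    where
    index : ∀ t k → 4 +ℕ (t +ℕ k) ≡ suc ((1 +ℕ t) +ℕ (2 +ℕ k))
    index = solve-∀

  det-xI-hankel : ∀ q x → let N = q ℕ.* 2 ; W = u (2 +ℕ N) in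
    (A * A) * det R (x I- hankel {2 +ℕ N})
    ≈ (A * A) * pow R x (2 +ℕ N) - A * W * v (3 +ℕ N) * pow R x (1 +ℕ N) - W * W * pow R x N
  det-xI-hankel q x = begin
    (A * A) * det R (x I- hankel {2 +ℕ N})
      ≈⟨ *-congˡ (det-xI-minus-rank-two {N} x hankel α β hankel-rank-two) ⟩
    (A * A) * (X * ((x - u 2 - S 0 0) * (x - u 4 - S 1 1) - (u 3 + S 0 1) * (u 3 + S 1 0)))
      ≈⟨ expand A X x (u 2) (u 4) (u 3) (u 3) (S 0 0) (S 1 1) (S 0 1) (S 1 0) ⟩
    X * ((A * A) * (x * x) - A * x * (A * (u 2 + S 0 0) + A * (u 4 + S 1 1))
         + (A * (u 2 + S 0 0) * (A * (u 4 + S 1 1)) - A * (u 3 + S 0 1) * (A * (u 3 + S 1 0))))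
      ≈⟨ *-congˡ (+-cong (+-congˡ (-‿cong (*-congˡ (+-cong (entry 0 0) (entry 1 1)))))
                         (+-cong (*-cong (entry 0 0) (entry 1 1)) (-‿cong (*-cong (entry 0 1) (entry 1 0))))) ⟩
    X * ((A * A) * (x * x) - A * x * (W * W + W * F) + (W * W * (W * F) - W * T * (W * T)))
      ≈⟨ factor A X x W T F ⟩
    (A * A) * (x * (x * X)) - A * W * (F + W) * (x * X) + W * W * X * (W * F - T * T)
      ≈⟨ +-cong (+-congˡ (-‿cong (*-congʳ (*-congˡ (sym (v-as-u (2 +ℕ N)))))))
                (*-congˡ (cassini-even (suc q))) ⟩
    (A * A) * (x * (x * X)) - A * W * v (3 +ℕ N) * (x * X) + W * W * X * - 1#
      ≈⟨ +-congˡ (negate (W * W * X)) ⟩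
    (A * A) * pow R x (2 +ℕ N) - A * W * v (3 +ℕ N) * pow R x (1 +ℕ N) - W * W * X  ∎
    where
    N = q ℕ.* 2
    α β : Fin N → Carrier
    α r = u (1 +ℕ toℕ r)
    β r = u (2 +ℕ toℕ r)
    X = pow R x N
    W = u (2 +ℕ N)
    T = u (3 +ℕ N)
    F = u (4 +ℕ N)
    S : ℕ → ℕ → Carrier
    S p s = product-sum p s N
    entry : ∀ p s → A * (u (2 +ℕ (p +ℕ s)) + S p s) ≈ W * u ((2 +ℕ (p +ℕ s)) +ℕ N)
    entry p s = trans (product-sum-even p s q)
                      (*-congˡ (u-cong (≡.cong (2 +ℕ_) (ℕ.+-comm N (p +ℕ s)))))
    expand : ∀ A X x p q r r′ s t w w′ →
      (A * A) * (X * ((x - p - s) * (x - q - t) - (r + w) * (r′ + w′)))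
      ≈ X * ((A * A) * (x * x) - A * x * (A * (p + s) + A * (q + t))
             + (A * (p + s) * (A * (q + t)) - A * (r + w) * (A * (r′ + w′))))
    expand = solve 11 (λ A X x p q r r′ s t w w′ →
      (A :* A) :* (X :* ((x :- p :- s) :* (x :- q :- t) :- (r :+ w) :* (r′ :+ w′))) ,
      X :* ((A :* A) :* (x :* x) :- A :* x :* (A :* (p :+ s) :+ A :* (q :+ t))
            :+ (A :* (p :+ s) :* (A :* (q :+ t)) :- A :* (r :+ w) :* (A :* (r′ :+ w′))))) refl
    factor : ∀ A X x W T F →
      X * ((A * A) * (x * x) - A * x * (W * W + W * F) + (W * W * (W * F) - W * T * (W * T)))
      ≈ (A * A) * (x * (x * X)) - A * W * (F + W) * (x * X) + W * W * X * (W * F - T * T)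
    factor = solve 6 (λ A X x W T F →
      X :* ((A :* A) :* (x :* x) :- A :* x :* (W :* W :+ W :* F)
            :+ (W :* W :* (W :* F) :- W :* T :* (W :* T))) ,
      (A :* A) :* (x :* (x :* X)) :- A :* W :* (F :+ W) :* (x :* X) :+ W :* W :* X :* (W :* F :- T :* T)) refl
    negate : ∀ y → y * - 1# ≈ - y
    negate = solve 1 (λ y → y :* (:- con 1ℤ) , :- y) refl

corollary1p13 : {c ℓ : Level} (R : CommutativeRing c ℓ) →
    let open CommutativeRing R in
    (A : Carrier) →
    ¬ (A * (A * A + (1# + 1# + 1# + 1#)) ≈ 0#) →
    (n : ℕ) → 0 < n → 2 ∣ n → (x : Carrier) →
    (A * A) * det R (λ (j k : Fin n) →
        x * δ R j k - lucasU R A (- 1#) ((toℕ j +ℕ 1) +ℕ (toℕ k +ℕ 1)))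
    ≈ (A * A) * pow R x n
      - A * lucasU R A (- 1#) n * lucasV R A (- 1#) (n +ℕ 1) * pow R x (n ∸ 1)
      - lucasU R A (- 1#) n * lucasU R A (- 1#) n * pow R x (n ∸ 2)
corollary1p13 R A _ n () (divides zero ≡.refl) x
corollary1p13 R A _ _ _ (divides (suc q) ≡.refl) x = begin
  (A * A) * det R (λ (j k : Fin n) → x * δ R j k - u ((toℕ j +ℕ 1) +ℕ (toℕ k +ℕ 1)))
    ≈⟨ *-congˡ (det-cong {n} λ j k → +-congˡ {x * δ R j k} (-‿cong (u-cong (index (toℕ j) (toℕ k))))) ⟩
  (A * A) * det R (x I- hankel {n})
    ≈⟨ det-xI-hankel q x ⟩
  (A * A) * pow R x n - A * u n * v (suc n) * pow R x (n ∸ 1) - u n * u n * pow R x (n ∸ 2)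
    ≈⟨ +-congʳ (+-congˡ (-‿cong (*-congʳ (*-congˡ (reflexive (≡.cong v (ℕₚ.+-comm 1 n))))))) ⟩
  (A * A) * pow R x n - A * u n * v (n +ℕ 1) * pow R x (n ∸ 1) - u n * u n * pow R x (n ∸ 2)  ∎
  where
  n = suc q ℕ.* 2
  open CommutativeRing R
  open Determinant R using (_I-_; det-cong)
  open Lucas R A using (u; v; u-cong)
  open Hankel R A using (hankel; det-xI-hankel)
  open import Relation.Binary.Reasoning.Setoid setoid
  index : ∀ j k → (j +ℕ 1) +ℕ (k +ℕ 1) ≡ 2 +ℕ (j +ℕ k)
  index = solve-∀
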